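{- For every integer $n\ge1$, $\mathrm{pk}_n(132,213,231)=\mathrm{pk}_n(132,213,312)=\mathrm{pk}_n(213,231,312)=\sum_{k=1}^nk!$.
   Context: For a positive integer $n$, $[n]=\{1,\dots,n\}$. A function $f:[n]\to[n]$ is a parking function if for every $i\in[n]$, $|\{j\in[n]: f(j)\le i\}|\ge i$ (equivalently, in the usual car-parking process where car $i$ prefers spot $f(i)$ and takes the first free spot at or after it, all cars park). The parking permutation $\rho_f\in S_n$ is defined by: spot $i$ is occupied by car $\rho_f(i)$. A permutation $\pi\in S_n$ contains $\sigma\in S_m$ as a pattern if there exist $1\le i_1<\dots<i_m\le n$ with $\pi(i_a)<\pi(i_b)$ iff $\sigma(a)<\sigma(b)$ for all $a,b$; otherwise it avoids $\sigma$. $\mathrm{pk}_n(\sigma_1,\dots,\sigma_k)$ is the number of parking functions $f:[n]\to[n]$ with $\rho_f$ avoiding every $\sigma_i$. -}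

module Defs where

-- Conventions: everything is 1-indexed as in the paper.
-- A function f : [n] → [n] is represented by the list [f(1), …, f(n)]
-- of natural numbers, each in {1,…,n}.  A permutation π ∈ S_m is the
-- list [π(1), …, π(m)] (one-line notation); patterns like 132 are [1,3,2].

open import Data.Nat using (ℕ; zero; suc; _+_; _<ᵇ_; _≤ᵇ_; _≡ᵇ_; _!)
open import Data.Bool using (Bool; true; false; _∧_; _∨_; not; if_then_else_)
open import Data.List using (List; []; _∷_; map; length; filter; concatMap; applyUpTo; zip; replicate)
open import Data.Bool.ListAction using (all; any)
open import Data.Nat.ListAction using (sum)
open import Data.Maybe using (Maybe; just; nothing)
open import Function using (_∘_)
open import Relation.Nullary.Decidable using (does)
open import Data.Bool.Properties using (T?)

range : ℕ → List ℕ
range n = applyUpTo suc n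

functions : ℕ → ℕ → List (List ℕ)
functions n zero    = [] ∷ []
functions n (suc k) = concatMap (λ v → map (v ∷_) (functions n k)) (range n)

countLe : ℕ → List ℕ → ℕ
countLe i []       = 0
countLe i (x ∷ xs) = (if x ≤ᵇ i then 1 else 0) + countLe i xs

isParking : ℕ → List ℕ → Bool
isParking n f = all (λ i → i ≤ᵇ countLe i f) (range n)

-- A state is the list of spots 1..n, each either
-- free (nothing) or occupied by a car (just c).
-- park c p s : car c, preferring spot p, takes the first free spot at or
-- after p (spot indices start at `pos`).
parkAt : ℕ → ℕ → ℕ → List (Maybe ℕ) → List (Maybe ℕ)
parkAt c p pos []                = []
parkAt c p pos (nothing ∷ s)     =
  if p ≤ᵇ pos then just c ∷ s else nothing ∷ parkAt c p (suc pos) s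
parkAt c p pos (just d ∷ s)      = just d ∷ parkAt c p (suc pos) s

runParking : ℕ → List ℕ → List (Maybe ℕ) → List (Maybe ℕ)
runParking c []       s = s
runParking c (p ∷ ps) s = runParking (suc c) ps (parkAt c p 1 s)

-- occupant list of a final state (unoccupied spots, which do not occur
-- for parking functions, are dropped)
occupants : List (Maybe ℕ) → List ℕ
occupants []             = []
occupants (nothing ∷ s)  = occupants s
occupants (just c ∷ s)   = c ∷ occupants s

parkingPermutation : ℕ → List ℕ → List ℕ
parkingPermutation n f = occupants (runParking 1 f (replicate n nothing))

subsequences : List ℕ → List (List ℕ)
subsequences []       = [] ∷ []
subsequences (x ∷ xs) = map (x ∷_) (subsequences xs) Data.List.++ subsequences xs

_⇔ᵇ_ : Bool → Bool → Bool
a ⇔ᵇ b = (a ∧ b) ∨ (not a ∧ not b)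

orderIsomorphic : List ℕ → List ℕ → Bool
orderIsomorphic []       []       = true
orderIsomorphic []       (_ ∷ _)  = false
orderIsomorphic (_ ∷ _)  []       = false
orderIsomorphic (x ∷ xs) (y ∷ ys) =
  all (λ p → ((x <ᵇ Data.Product.proj₁ p) ⇔ᵇ (y <ᵇ Data.Product.proj₂ p))
           ∧ ((Data.Product.proj₁ p <ᵇ x) ⇔ᵇ (Data.Product.proj₂ p <ᵇ y)))
      (zip xs ys)
  ∧ orderIsomorphic xs ys
  where import Data.Product

contains : List ℕ → List ℕ → Bool
contains π σ = any (λ τ → orderIsomorphic τ σ) (subsequences π)

avoidsAll : List ℕ → List (List ℕ) → Bool
avoidsAll π σs = all (λ σ → not (contains π σ)) σs

pk : ℕ → List (List ℕ) → ℕ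
pk n σs = length (filter (λ f → T? (isParking n f ∧ avoidsAll (parkingPermutation n f) σs))
                         (functions n n))

sumFactorials : ℕ → ℕ
sumFactorials n = sum (map _! (range n))

-- A parking process is a walk through partially filled lots: from a lot with
-- vacancies, the next car lands in a given vacancy for exactly as many preferences
-- as there are spots after the previous vacancy up to it.  Counting parking
-- functions whose permutation avoids a set of patterns is therefore a weighted
-- recursion over lots.  A lot contributes nothing once three of its spots force a
-- forbidden pattern in every completion; such triples are easy to find because a
-- vacancy can only receive a car larger than every car already parked.  For each of
-- the three pattern sets the remaining lots form two explicit families whose counts
-- are rising factorials, adding up to 1! + ⋯ + n!.

module Submission where

open import Data.Bool using (Bool; true; false; T; _∧_; not; if_then_else_)
open import Data.Bool.ListAction using (all; any)
open import Data.Bool.Properties using (T?; T-∧; T-≡)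
open import Data.Empty using (⊥; ⊥-elim)
open import Data.List
  using (List; []; _∷_; _++_; [_]; map; length; reverse; filterᵇ; concatMap; replicate; iterate; applyUpTo; applyDownFrom)
open import Data.List.Properties
  using (++-identityʳ; ++-assoc; map-++; map-cong; map-cong-local; length-++; length-replicate; length-applyUpTo;
         filter-++; filter-≐; filter-none; filter-accept; applyUpTo-∷ʳ; map-applyUpTo; reverse-applyDownFrom)
open import Data.List.Membership.Propositional using (_∈_; lose; find)
open import Data.List.Membership.Propositional.Properties using (∈-++⁺ˡ; ∈-++⁺ʳ; ∈-++⁻; ∈-map⁺; ∈-map⁻)
open import Data.List.Relation.Binary.Permutation.Propositional.Properties using (↭-reverse)
open import Data.List.Relation.Binary.Pointwise using (Pointwise; []; _∷_)
import Data.List.Relation.Binary.Pointwise as Pointwise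
open import Data.List.Relation.Binary.Sublist.Heterogeneous using (Sublist; []; _∷_; _∷ʳ_; minimum)
open import Data.List.Relation.Binary.Sublist.Heterogeneous.Properties using (++ˡ)
open import Data.List.Relation.Binary.Sublist.Propositional using (_⊆_)
open import Data.List.Relation.Binary.Sublist.Propositional.Properties using (All-resp-⊆; map⁺)
open import Data.List.Relation.Unary.All using (All; []; _∷_)
import Data.List.Relation.Unary.All as All
open import Data.List.Relation.Unary.All.Properties
  using (all⁺; all⁻; applyUpTo⁺₁; applyUpTo⁻; applyDownFrom⁺₁; All¬⇒¬Any)
open import Data.List.Relation.Unary.AllPairs using (AllPairs; []; _∷_)
import Data.List.Relation.Unary.AllPairs as AllPairs
import Data.List.Relation.Unary.AllPairs.Properties as AllPairs
open import Data.List.Relation.Unary.Any using (Any; here; there)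
import Data.List.Relation.Unary.Any as Any
open import Data.List.Relation.Unary.Any.Properties using (any⁺; any⁻)
open import Data.Maybe using (Maybe; just; nothing; is-just; is-nothing)
open import Data.Nat using (ℕ; zero; suc; _+_; _*_; _≤_; _<_; _≥_; _>_; _≤ᵇ_; _<ᵇ_; _!; z≤n; s≤s; s≤s⁻¹; z<s)
open import Data.Nat.ListAction using (sum)
open import Data.Nat.ListAction.Properties using (sum-↭)
open import Data.Nat.Properties
open import Data.Product using (_×_; _,_; proj₁; proj₂; ∃; ∃₂)
open import Data.Sum using (_⊎_; inj₁; inj₂)
open import Function using (_∘_; _⇔_; Equivalence; mk⇔)
open import Relation.Binary.Definitions using (tri<; tri≈; tri>)
open import Relation.Binary.PropositionalEquality
  using (_≡_; _≢_; refl; sym; trans; cong; cong₂; subst; ≢-sym; module ≡-Reasoning)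
open import Relation.Nullary using (¬_; contradiction; yes; no)

open import Defs

private
  variable
    A B : Set

countᵇ : (A → Bool) → List A → ℕ
countᵇ p xs = length (filterᵇ p xs)

countᵇ-++ : (p : A → Bool) (xs ys : List A) → countᵇ p (xs ++ ys) ≡ countᵇ p xs + countᵇ p ys
countᵇ-++ p xs ys = trans (cong length (filter-++ (T? ∘ p) xs ys)) (length-++ (filterᵇ p xs))

countᵇ-map : (p : B → Bool) (f : A → B) (xs : List A) → countᵇ p (map f xs) ≡ countᵇ (p ∘ f) xs
countᵇ-map p f []       = refl
countᵇ-map p f (x ∷ xs) with p (f x)
... | true  = cong suc (countᵇ-map p f xs)
... | false = countᵇ-map p f xs

countᵇ-concatMap : (p : B → Bool) (f : A → List B) (xs : List A) →
                   countᵇ p (concatMap f xs) ≡ sum (map (countᵇ p ∘ f) xs)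
countᵇ-concatMap p f []       = refl
countᵇ-concatMap p f (x ∷ xs) =
  trans (countᵇ-++ p (f x) (concatMap f xs)) (cong (countᵇ p (f x) +_) (countᵇ-concatMap p f xs))

countᵇ-cong : {p q : A → Bool} → (∀ x → p x ≡ q x) → (xs : List A) → countᵇ p xs ≡ countᵇ q xs
countᵇ-cong p≗q xs =
  cong length (filter-≐ (T? ∘ _) (T? ∘ _) ((λ {x} → subst T (p≗q x)) , (λ {x} → subst T (sym (p≗q x)))) xs)

countᵇ-none : {p : A → Bool} {xs : List A} → All (λ x → ¬ T (p x)) xs → countᵇ p xs ≡ 0
countᵇ-none {p = p} never = cong length (filter-none (T? ∘ p) never)

sum-map-zero : ∀ (f : A → ℕ) xs → (∀ x → f x ≡ 0) → sum (map f xs) ≡ 0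
sum-map-zero f []       f≡0 = refl
sum-map-zero f (x ∷ xs) f≡0 = cong₂ _+_ (f≡0 x) (sum-map-zero f xs f≡0)

T-injective : {a b : Bool} → (T a ⇔ T b) → a ≡ b
T-injective {false} {false} _   = refl
T-injective {false} {true}  a⇔b = ⊥-elim (Equivalence.from a⇔b _)
T-injective {true}  {false} a⇔b = ⊥-elim (Equivalence.to a⇔b _)
T-injective {true}  {true}  _   = refl

¬T⇒≡false : {b : Bool} → ¬ T b → b ≡ false
¬T⇒≡false {false} _  = refl
¬T⇒≡false {true}  ¬b = ⊥-elim (¬b _)

¬T⇒T-not : ∀ {b} → ¬ T b → T (not b)
¬T⇒T-not {false} _  = _
¬T⇒T-not {true}  ¬b = ¬b _

T-not⇒¬T : ∀ {b} → T (not b) → ¬ T b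
T-not⇒¬T {false} _ ()

≤ᵇ-true : ∀ {m n} → m ≤ n → (m ≤ᵇ n) ≡ true
≤ᵇ-true m≤n = Equivalence.to T-≡ (≤⇒≤ᵇ m≤n)

≤ᵇ-false : ∀ {m n} → n < m → (m ≤ᵇ n) ≡ false
≤ᵇ-false {m} {n} n<m = ¬T⇒≡false (λ m≤ᵇn → <⇒≱ n<m (≤ᵇ⇒≤ m n m≤ᵇn))

<ᵇ-true : ∀ {m n} → m < n → (m <ᵇ n) ≡ true
<ᵇ-true m<n = Equivalence.to T-≡ (<⇒<ᵇ m<n)

<ᵇ-false : ∀ {m n} → n ≤ m → (m <ᵇ n) ≡ false
<ᵇ-false {m} {n} n≤m = ¬T⇒≡false (λ m<ᵇn → <⇒≱ (<ᵇ⇒< m n m<ᵇn) n≤m)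

<+1⇒≤ : ∀ {m n} → m < n + 1 → m ≤ n
<+1⇒≤ {m} {n} m<n+1 = m<1+n⇒m≤n (subst (m <_) (+-comm n 1) m<n+1)

Lot : Set
Lot = List (Maybe ℕ)

vacant : ℕ → Lot
vacant k = replicate k nothing

parked : List ℕ → Lot
parked = map just

isFull : Lot → Bool
isFull = all is-just

vacancies : Lot → ℕ
vacancies = countᵇ is-nothing

vacant-suc : ∀ k s → vacant (suc k) ++ s ≡ vacant k ++ nothing ∷ s
vacant-suc zero    s = refl
vacant-suc (suc k) s = cong (nothing ∷_) (vacant-suc k s)

occupants-vacant-++ : ∀ k s → occupants (vacant k ++ s) ≡ occupants s
occupants-vacant-++ zero    s = refl
occupants-vacant-++ (suc k) s = occupants-vacant-++ k s

occupants-parked-++ : ∀ X s → occupants (parked X ++ s) ≡ X ++ occupants s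
occupants-parked-++ []      s = refl
occupants-parked-++ (x ∷ X) s = cong (x ∷_) (occupants-parked-++ X s)

occupants-parked : ∀ X → occupants (parked X) ≡ X
occupants-parked []      = refl
occupants-parked (x ∷ X) = cong (x ∷_) (occupants-parked X)

isFull-parked : ∀ X → T (isFull (parked X))
isFull-parked []      = _
isFull-parked (x ∷ X) = isFull-parked X

isFull⇒parked : ∀ s → T (isFull s) → s ≡ parked (occupants s)
isFull⇒parked []           _    = refl
isFull⇒parked (just x ∷ s) full = cong (just x ∷_) (isFull⇒parked s full)

vacancies-vacant : ∀ k → vacancies (vacant k) ≡ k
vacancies-vacant zero    = refl
vacancies-vacant (suc k) = cong suc (vacancies-vacant k)

vacancies-parked : ∀ X → vacancies (parked X) ≡ 0
vacancies-parked []      = refl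
vacancies-parked (x ∷ X) = vacancies-parked X

vacancies-vacant-++ : ∀ k s → vacancies (vacant k ++ s) ≡ k + vacancies s
vacancies-vacant-++ zero    s = refl
vacancies-vacant-++ (suc k) s = cong suc (vacancies-vacant-++ k s)

vacancies-parked-++ : ∀ X s → vacancies (parked X ++ s) ≡ vacancies s
vacancies-parked-++ []      s = refl
vacancies-parked-++ (x ∷ X) s = vacancies-parked-++ X s

vacancies-vacant-parked : ∀ k X → vacancies (vacant k ++ parked X) ≡ k
vacancies-vacant-parked k X =
  trans (vacancies-vacant-++ k (parked X)) (trans (cong (k +_) (vacancies-parked X)) (+-identityʳ k))

isFull-vacancies : ∀ s → T (isFull s) → vacancies s ≡ 0
isFull-vacancies []           _    = refl
isFull-vacancies (just _ ∷ s) full = isFull-vacancies s full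

length-parkAt : ∀ c p pos s → length (parkAt c p pos s) ≡ length s
length-parkAt c p pos []            = refl
length-parkAt c p pos (just d ∷ s)  = cong suc (length-parkAt c p (suc pos) s)
length-parkAt c p pos (nothing ∷ s) with p ≤ᵇ pos
... | true  = refl
... | false = cong suc (length-parkAt c p (suc pos) s)

length-runParking : ∀ c ps s → length (runParking c ps s) ≡ length s
length-runParking c []       s = refl
length-runParking c (p ∷ ps) s = trans (length-runParking (suc c) ps (parkAt c p 1 s)) (length-parkAt c p 1 s)

parkAt-≤ : ∀ c {v pos} s → v ≤ pos → parkAt c v pos s ≡ parkAt c 0 pos s
parkAt-≤ c []            v≤pos = refl
parkAt-≤ c (just d ∷ s)  v≤pos = cong (just d ∷_) (parkAt-≤ c s (m≤n⇒m≤1+n v≤pos))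
parkAt-≤ c (nothing ∷ s) v≤pos rewrite ≤ᵇ-true v≤pos = refl

parkAt-> : ∀ c {v pos} x s → pos < v → parkAt c v pos (x ∷ s) ≡ x ∷ parkAt c v (suc pos) s
parkAt-> c (just d) s pos<v = refl
parkAt-> c nothing  s pos<v rewrite ≤ᵇ-false pos<v = refl

vacancies-parkAt : ∀ c p pos s → vacancies s ≤ suc (vacancies (parkAt c p pos s))
vacancies-parkAt c p pos []            = z≤n
vacancies-parkAt c p pos (just d ∷ s)  = vacancies-parkAt c p (suc pos) s
vacancies-parkAt c p pos (nothing ∷ s) with p ≤ᵇ pos
... | true  = ≤-refl
... | false = s≤s (vacancies-parkAt c p (suc pos) s)

-- Parking functions are the preference lists that fill the lot

indicator : Bool → ℕ
indicator b = if b then 1 else 0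

occupiedUpTo : ℕ → ℕ → Lot → ℕ
occupiedUpTo i pos []            = 0
occupiedUpTo i pos (nothing ∷ s) = occupiedUpTo i (suc pos) s
occupiedUpTo i pos (just _ ∷ s)  = indicator (pos ≤ᵇ i) + occupiedUpTo i (suc pos) s

occupiedUpTo-vacant : ∀ i pos k → occupiedUpTo i pos (vacant k) ≡ 0
occupiedUpTo-vacant i pos zero    = refl
occupiedUpTo-vacant i pos (suc k) = occupiedUpTo-vacant i (suc pos) k

occupiedUpTo-below : ∀ i pos s → i < pos → occupiedUpTo i pos s ≡ 0
occupiedUpTo-below i pos []            i<pos = refl
occupiedUpTo-below i pos (nothing ∷ s) i<pos = occupiedUpTo-below i (suc pos) s (m<n⇒m<1+n i<pos)
occupiedUpTo-below i pos (just _ ∷ s)  i<pos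
  rewrite ≤ᵇ-false i<pos = occupiedUpTo-below i (suc pos) s (m<n⇒m<1+n i<pos)

occupiedUpTo-parkAt : ∀ i c p pos s →
  occupiedUpTo i pos (parkAt c p pos s) ≤ occupiedUpTo i pos s + indicator (p ≤ᵇ i)
occupiedUpTo-parkAt i c p pos [] = z≤n
occupiedUpTo-parkAt i c p pos (just _ ∷ s) =
  ≤-trans (+-monoʳ-≤ (indicator (pos ≤ᵇ i)) (occupiedUpTo-parkAt i c p (suc pos) s))
          (≤-reflexive (sym (+-assoc (indicator (pos ≤ᵇ i)) _ _)))
occupiedUpTo-parkAt i c p pos (nothing ∷ s) with p ≤? pos
... | no p≰pos rewrite ≤ᵇ-false (≰⇒> p≰pos) = occupiedUpTo-parkAt i c p (suc pos) s
... | yes p≤pos rewrite ≤ᵇ-true p≤pos with pos ≤? i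
...   | no pos≰i rewrite ≤ᵇ-false (≰⇒> pos≰i) = m≤m+n _ _
...   | yes pos≤i rewrite ≤ᵇ-true pos≤i | ≤ᵇ-true (≤-trans p≤pos pos≤i) = ≤-reflexive (+-comm 1 _)

occupiedUpTo-runParking : ∀ i c ps s →
  occupiedUpTo i 1 (runParking c ps s) ≤ occupiedUpTo i 1 s + countLe i ps
occupiedUpTo-runParking i c []       s = m≤m+n _ _
occupiedUpTo-runParking i c (p ∷ ps) s = begin
  occupiedUpTo i 1 (runParking (suc c) ps (parkAt c p 1 s))        ≤⟨ occupiedUpTo-runParking i (suc c) ps _ ⟩
  occupiedUpTo i 1 (parkAt c p 1 s) + countLe i ps                 ≤⟨ +-monoˡ-≤ _ (occupiedUpTo-parkAt i c p 1 s) ⟩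
  occupiedUpTo i 1 s + indicator (p ≤ᵇ i) + countLe i ps           ≡⟨ +-assoc (occupiedUpTo i 1 s) _ _ ⟩
  occupiedUpTo i 1 s + countLe i (p ∷ ps)                          ∎
  where open ≤-Reasoning

full-occupiedUpTo : ∀ i pos s → T (isFull s) → i < pos + length s → suc i ≤ pos + occupiedUpTo i pos s
full-occupiedUpTo i pos []           _    i<end = i<end
full-occupiedUpTo i pos (just _ ∷ s) full i<end with pos ≤? i
... | no pos≰i rewrite ≤ᵇ-false (≰⇒> pos≰i) = ≤-trans (≰⇒> pos≰i) (m≤m+n pos _)
... | yes pos≤i rewrite ≤ᵇ-true pos≤i =
  ≤-trans (full-occupiedUpTo i (suc pos) s full (subst (i <_) (+-suc pos (length s)) i<end))
          (≤-reflexive (sym (+-suc pos _)))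

data VacantAt : ℕ → ℕ → Lot → Set where
  here  : ∀ {pos s} → VacantAt pos pos (nothing ∷ s)
  there : ∀ {h pos x s} → VacantAt h (suc pos) s → VacantAt h pos (x ∷ s)

vacantAt-bounds : ∀ {h pos s} → VacantAt h pos s → pos ≤ h × h < pos + length s
vacantAt-bounds {pos = pos} {nothing ∷ s} here = ≤-refl , subst (pos <_) (sym (+-suc pos (length s))) (s≤s (m≤m+n pos _))
vacantAt-bounds {h} {pos} {x ∷ s} (there v) with vacantAt-bounds v
... | pos<h , h<end = <⇒≤ pos<h , subst (h <_) (sym (+-suc pos (length s))) h<end

notFull-vacantAt : ∀ pos s → ¬ T (isFull s) → ∃ λ h → VacantAt h pos s
notFull-vacantAt pos []            notFull = ⊥-elim (notFull _)
notFull-vacantAt pos (nothing ∷ s) notFull = pos , here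
notFull-vacantAt pos (just _ ∷ s)  notFull with notFull-vacantAt (suc pos) s notFull
... | h , v = h , there v

vacantAt-occupiedUpTo : ∀ {h pos s} → VacantAt h pos s → pos + occupiedUpTo h pos s ≤ h
vacantAt-occupiedUpTo {pos = pos} {nothing ∷ s} here
  rewrite occupiedUpTo-below pos (suc pos) s (n<1+n pos) = ≤-reflexive (+-identityʳ pos)
vacantAt-occupiedUpTo {h} {pos} {nothing ∷ s} (there v) = ≤-trans (+-monoˡ-≤ _ (n≤1+n pos)) (vacantAt-occupiedUpTo v)
vacantAt-occupiedUpTo {h} {pos} {just _ ∷ s} (there v)
  rewrite ≤ᵇ-true (<⇒≤ (proj₁ (vacantAt-bounds v))) = ≤-trans (≤-reflexive (+-suc pos _)) (vacantAt-occupiedUpTo v)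

-- A car that leaves spot h vacant parks below h exactly when it prefers a spot ≤ h.
vacantAt-parkAt : ∀ {h} c p pos s → VacantAt h pos (parkAt c p pos s) →
  VacantAt h pos s × occupiedUpTo h pos (parkAt c p pos s) ≡ occupiedUpTo h pos s + indicator (p ≤ᵇ h)
vacantAt-parkAt {h} c p pos (just d ∷ s) (there v) with vacantAt-parkAt c p (suc pos) s v
... | v′ , eq = there v′ , trans (cong (indicator (pos ≤ᵇ h) +_) eq) (sym (+-assoc (indicator (pos ≤ᵇ h)) _ _))
vacantAt-parkAt {h} c p pos (nothing ∷ s) v with p ≤? pos
vacantAt-parkAt {h} c p pos (nothing ∷ s) v | yes p≤pos rewrite ≤ᵇ-true p≤pos with v
... | there v′ rewrite ≤ᵇ-true (<⇒≤ (proj₁ (vacantAt-bounds v′)))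
                     | ≤ᵇ-true (≤-trans p≤pos (<⇒≤ (proj₁ (vacantAt-bounds v′)))) = there v′ , +-comm 1 _
vacantAt-parkAt {h} c p pos (nothing ∷ s) v | no p≰pos rewrite ≤ᵇ-false (≰⇒> p≰pos) with v
... | here rewrite ≤ᵇ-false (≰⇒> p≰pos) | occupiedUpTo-below pos (suc pos) s (n<1+n pos)
                 | occupiedUpTo-below pos (suc pos) (parkAt c p (suc pos) s) (n<1+n pos) = here , refl
... | there v′ with vacantAt-parkAt c p (suc pos) s v′
...   | v″ , eq = there v″ , eq

vacantAt-runParking : ∀ {h} c ps s → VacantAt h 1 (runParking c ps s) →
  occupiedUpTo h 1 (runParking c ps s) ≡ occupiedUpTo h 1 s + countLe h ps
vacantAt-runParking c ps s v = proj₂ (go c ps s v)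
  where
  go : ∀ {h} c ps s → VacantAt h 1 (runParking c ps s) →
       VacantAt h 1 s × occupiedUpTo h 1 (runParking c ps s) ≡ occupiedUpTo h 1 s + countLe h ps
  go c []       s v = v , sym (+-identityʳ _)
  go {h} c (p ∷ ps) s v with go (suc c) ps (parkAt c p 1 s) v
  ... | v′ , eq with vacantAt-parkAt c p 1 s v′
  ...   | v″ , eq′ = v″ , trans eq (trans (cong (_+ countLe h ps) eq′) (+-assoc (occupiedUpTo h 1 s) _ _))

isParking≡isFull : ∀ n f → isParking n f ≡ isFull (runParking 1 f (vacant n))
isParking≡isFull n f = T-injective (mk⇔ parking⇒full full⇒parking)
  where
  F = runParking 1 f (vacant n)

  length-F : length F ≡ n
  length-F = trans (length-runParking 1 f (vacant n)) (length-replicate n)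

  occupied≤count : ∀ i → occupiedUpTo i 1 F ≤ countLe i f
  occupied≤count i = subst (λ k → occupiedUpTo i 1 F ≤ k + countLe i f) (occupiedUpTo-vacant i 1 n)
                           (occupiedUpTo-runParking i 1 f (vacant n))

  full⇒parking : T (isFull F) → T (isParking n f)
  full⇒parking full = all⁻ _ (applyUpTo⁺₁ suc n (λ {i} i<n →
    ≤⇒≤ᵇ (≤-trans (s≤s⁻¹ (full-occupiedUpTo (suc i) 1 F full (s≤s (subst (i <_) (sym length-F) i<n))))
                  (occupied≤count (suc i)))))

  parking⇒full : T (isParking n f) → T (isFull F)
  parking⇒full parking with T? (isFull F)
  ... | yes full   = full
  ... | no notFull with notFull-vacantAt 1 F notFull
  ...   | zero  , v = ⊥-elim (1+n≰n (proj₁ (vacantAt-bounds v)))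
  ...   | suc i , v = ⊥-elim (<⇒≱ count<h h≤count)
    where
    h≤count : suc i ≤ countLe (suc i) f
    h≤count = ≤ᵇ⇒≤ _ _ (applyUpTo⁻ suc n (all⁺ _ _ parking)
                                  (s≤s⁻¹ (subst (suc i <_) (cong suc length-F) (proj₂ (vacantAt-bounds v)))))
    count<h : countLe (suc i) f < suc i
    count<h = subst (λ k → suc k ≤ suc i)
                    (trans (vacantAt-runParking 1 f (vacant n) v) (cong (_+ countLe (suc i) f) (occupiedUpTo-vacant (suc i) 1 n)))
                    (vacantAt-occupiedUpTo v)

fullAvoiding : List (List ℕ) → Lot → Bool
fullAvoiding σs F = isFull F ∧ avoidsAll (occupants F) σs

completesAvoiding : List (List ℕ) → ℕ → Lot → List ℕ → Bool
completesAvoiding σs c s ps = fullAvoiding σs (runParking c ps s)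

ways : List (List ℕ) → ℕ → Lot → ℕ → ℕ
ways σs c s m = countᵇ (completesAvoiding σs c s) (functions (length s) m)

pk≡ways : ∀ n σs → pk n σs ≡ ways σs 1 (vacant n) n
pk≡ways n σs = trans
  (countᵇ-cong (λ f → cong (_∧ avoidsAll (parkingPermutation n f) σs) (isParking≡isFull n f)) (functions n n))
  (cong (λ k → countᵇ (completesAvoiding σs 1 (vacant n)) (functions k n)) (sym (length-replicate n)))

ways-suc : ∀ σs c s m →
  ways σs c s (suc m) ≡ sum (map (λ v → ways σs (suc c) (parkAt c v 1 s) m) (range (length s)))
ways-suc σs c s m =
  trans (countᵇ-concatMap (completesAvoiding σs c s) (λ v → map (v ∷_) (functions (length s) m)) (range (length s)))
  (cong sum (map-cong (λ v → trans (countᵇ-map (completesAvoiding σs c s) (v ∷_) (functions (length s) m))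
                                   (cong (λ k → countᵇ (completesAvoiding σs (suc c) (parkAt c v 1 s)) (functions k m))
                                         (sym (length-parkAt c v 1 s))))
                      (range (length s))))

ways-overfull : ∀ σs c s m → m < vacancies s → ways σs c s m ≡ 0
ways-overfull σs c s zero    0<vac = countᵇ-none {p = completesAvoiding σs c s} {xs = [] ∷ []} ((λ good →
  contradiction (isFull-vacancies s (proj₁ (Equivalence.to T-∧ good))) (≢-sym (<⇒≢ 0<vac))) ∷ [])
ways-overfull σs c s (suc m) m<vac = trans (ways-suc σs c s m) (sum-map-zero _ (range (length s)) (λ v →
  ways-overfull σs (suc c) (parkAt c v 1 s) m (s≤s⁻¹ (≤-trans m<vac (vacancies-parkAt c v 1 s)))))

ways-parked : ∀ σs c π → T (avoidsAll π σs) → ways σs c (parked π) 0 ≡ 1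
ways-parked σs c π avoids =
  cong length (filter-accept (T? ∘ completesAvoiding σs c (parked π)) {x = []} {xs = []}
    (Equivalence.from T-∧ (isFull-parked π , subst (λ ρ → T (avoidsAll ρ σs)) (sym (occupants-parked π)) avoids)))

-- landings g c w s sums g over the lots left by car c, one term per preference,
-- when w preferences from the left already pass the first spot of s.  Preferences
-- with which c finds no vacancy are not counted.
landings : (Lot → ℕ) → ℕ → ℕ → Lot → ℕ
landings g c w []            = 0
landings g c w (nothing ∷ s) = suc w * g (just c ∷ s) + landings (g ∘ (nothing ∷_)) c 0 s
landings g c w (just d ∷ s)  = landings (g ∘ (just d ∷_)) c (suc w) s

iterate-suc-≥ : ∀ a k → All (a ≤_) (iterate suc a k)
iterate-suc-≥ a zero    = []
iterate-suc-≥ a (suc k) = ≤-refl ∷ All.map (≤-trans (n≤1+n a)) (iterate-suc-≥ (suc a) k)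

applyUpTo≡iterate : ∀ f a n → (∀ i → f i ≡ i + a) → applyUpTo f n ≡ iterate suc a n
applyUpTo≡iterate f a zero    f≗ = refl
applyUpTo≡iterate f a (suc n) f≗ =
  cong₂ _∷_ (f≗ 0) (applyUpTo≡iterate (f ∘ suc) (suc a) n (λ i → trans (f≗ (suc i)) (sym (+-suc i a))))

*-+-suc-assoc : ∀ w x y → w * x + (x + y) ≡ suc w * x + y
*-+-suc-assoc w x y = trans (sym (+-assoc (w * x) x y)) (cong (_+ y) (+-comm (w * x) x))

sum-parkAt≡landings : ∀ g c w pos s → g s ≡ 0 →
  w * g (parkAt c 0 pos s) + sum (map (λ v → g (parkAt c v pos s)) (iterate suc pos (length s))) ≡ landings g c w s
sum-parkAt≡landings g c w pos [] g[]≡0 = trans (+-identityʳ _) (trans (cong (w *_) g[]≡0) (*-zeroʳ w))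
sum-parkAt≡landings g c w pos (nothing ∷ s) gs≡0 = begin
  w * g (just c ∷ s) + (g (parkAt c pos pos (nothing ∷ s)) + rest)
    ≡⟨ cong (λ t → w * g (just c ∷ s) + (g t + rest)) (parkAt-≤ c (nothing ∷ s) (≤-refl {pos})) ⟩
  w * g (just c ∷ s) + (g (just c ∷ s) + rest)
    ≡⟨ *-+-suc-assoc w _ _ ⟩
  suc w * g (just c ∷ s) + rest
    ≡⟨ cong (λ t → suc w * g (just c ∷ s) + sum t)
            (map-cong-local (All.map (λ pos<v → cong g (parkAt-> c nothing s pos<v)) (iterate-suc-≥ (suc pos) (length s)))) ⟩
  suc w * g (just c ∷ s) + sum (map (λ v → g (nothing ∷ parkAt c v (suc pos) s)) (iterate suc (suc pos) (length s)))
    ≡⟨ cong (suc w * g (just c ∷ s) +_) (sum-parkAt≡landings (g ∘ (nothing ∷_)) c 0 (suc pos) s gs≡0) ⟩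
  landings g c w (nothing ∷ s) ∎
  where
  open ≡-Reasoning
  rest = sum (map (λ v → g (parkAt c v pos (nothing ∷ s))) (iterate suc (suc pos) (length s)))
sum-parkAt≡landings g c w pos (just d ∷ s) gs≡0 = begin
  w * g (just d ∷ parkAt c 0 (suc pos) s) + (g (just d ∷ parkAt c pos (suc pos) s) + rest)
    ≡⟨ cong (λ t → w * g (just d ∷ parkAt c 0 (suc pos) s) + (g (just d ∷ t) + rest)) (parkAt-≤ c s (n≤1+n pos)) ⟩
  w * g (just d ∷ parkAt c 0 (suc pos) s) + (g (just d ∷ parkAt c 0 (suc pos) s) + rest)
    ≡⟨ *-+-suc-assoc w _ _ ⟩
  suc w * g (just d ∷ parkAt c 0 (suc pos) s) + rest
    ≡⟨ sum-parkAt≡landings (g ∘ (just d ∷_)) c (suc w) (suc pos) s gs≡0 ⟩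
  landings g c w (just d ∷ s) ∎
  where
  open ≡-Reasoning
  rest = sum (map (λ v → g (just d ∷ parkAt c v (suc pos) s)) (iterate suc (suc pos) (length s)))

-- A preference with which car c finds no vacancy leaves more vacancies than cars.
ways-step : ∀ σs c s m → vacancies s ≡ suc m →
  ways σs c s (suc m) ≡ landings (λ t → ways σs (suc c) t m) c 0 s
ways-step σs c s m vac = begin
  ways σs c s (suc m)
    ≡⟨ ways-suc σs c s m ⟩
  sum (map (λ v → ways σs (suc c) (parkAt c v 1 s) m) (range (length s)))
    ≡⟨ cong (λ vs → sum (map (λ v → ways σs (suc c) (parkAt c v 1 s) m) vs))
            (applyUpTo≡iterate suc 1 (length s) (λ i → sym (+-comm i 1))) ⟩
  sum (map (λ v → ways σs (suc c) (parkAt c v 1 s) m) (iterate suc 1 (length s)))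
    ≡⟨ sum-parkAt≡landings (λ t → ways σs (suc c) t m) c 0 1 s (ways-overfull σs (suc c) s m (≤-reflexive (sym vac))) ⟩
  landings (λ t → ways σs (suc c) t m) c 0 s ∎
  where open ≡-Reasoning

landings-parked-++ : ∀ g c w X s → landings g c w (parked X ++ s) ≡ landings (g ∘ (parked X ++_)) c (length X + w) s
landings-parked-++ g c w []      s = refl
landings-parked-++ g c w (x ∷ X) s =
  trans (landings-parked-++ (g ∘ (just x ∷_)) c (suc w) X s)
        (cong (λ w′ → landings (g ∘ (parked (x ∷ X) ++_)) c w′ s) (+-suc (length X) w))

landings-parked : ∀ g c w X → landings g c w (parked X) ≡ 0
landings-parked g c w []      = refl
landings-parked g c w (x ∷ X) = landings-parked (g ∘ (just x ∷_)) c (suc w) X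

landings-vacant-++ : ∀ g c e s (h : ℕ → ℕ) →
  (∀ i j → suc (i + j) ≡ e → g (vacant i ++ just c ∷ vacant j ++ s) ≡ h j) →
  landings g c 0 (vacant e ++ s) ≡ sum (applyDownFrom h e) + landings (g ∘ (vacant e ++_)) c 0 s
landings-vacant-++ g c zero    s h g≡h = refl
landings-vacant-++ g c (suc e) s h g≡h = begin
  1 * g (just c ∷ vacant e ++ s) + landings (g ∘ (nothing ∷_)) c 0 (vacant e ++ s)
    ≡⟨ cong₂ _+_ (trans (*-identityˡ _) (g≡h 0 e refl))
                 (landings-vacant-++ (g ∘ (nothing ∷_)) c e s h (λ i j eq → g≡h (suc i) j (cong suc eq))) ⟩
  h e + (sum (applyDownFrom h e) + landings (g ∘ (vacant (suc e) ++_)) c 0 s)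
    ≡⟨ sym (+-assoc (h e) _ _) ⟩
  sum (applyDownFrom h (suc e)) + landings (g ∘ (vacant (suc e) ++_)) c 0 s ∎
  where open ≡-Reasoning

landings-vacant-++-vanishing : ∀ g c e s → (∀ i j → suc (i + j) ≡ e → g (vacant i ++ just c ∷ vacant j ++ s) ≡ 0) →
  landings g c 0 (vacant e ++ s) ≡ landings (g ∘ (vacant e ++_)) c 0 s
landings-vacant-++-vanishing g c e s g≡0 =
  trans (landings-vacant-++ g c e s (λ _ → 0) g≡0) (cong (_+ landings (g ∘ (vacant e ++_)) c 0 s) (sum-zeros e))
  where
  sum-zeros : ∀ e → sum (applyDownFrom (λ _ → 0) e) ≡ 0
  sum-zeros zero    = refl
  sum-zeros (suc e) = sum-zeros e

ways-step-parked : ∀ σs c X t m → vacancies t ≡ m →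
  ways σs c (parked X ++ nothing ∷ t) (suc m)
    ≡ suc (length X) * ways σs (suc c) (parked X ++ just c ∷ t) m
      + landings (λ u → ways σs (suc c) (parked X ++ nothing ∷ u) m) c 0 t
ways-step-parked σs c X t m vac = begin
  ways σs c (parked X ++ nothing ∷ t) (suc m)
    ≡⟨ ways-step σs c (parked X ++ nothing ∷ t) m (trans (vacancies-parked-++ X (nothing ∷ t)) (cong suc vac)) ⟩
  landings (λ u → ways σs (suc c) u m) c 0 (parked X ++ nothing ∷ t)
    ≡⟨ landings-parked-++ (λ u → ways σs (suc c) u m) c 0 X (nothing ∷ t) ⟩
  suc (length X + 0) * ways σs (suc c) (parked X ++ just c ∷ t) m + later
    ≡⟨ cong (λ l → suc l * ways σs (suc c) (parked X ++ just c ∷ t) m + later) (+-identityʳ (length X)) ⟩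
  suc (length X) * ways σs (suc c) (parked X ++ just c ∷ t) m
    + later ∎
  where
  open ≡-Reasoning
  later = landings (λ u → ways σs (suc c) (parked X ++ nothing ∷ u) m) c 0 t

-- Patterns of length three

⊆⇒∈-subsequences : ∀ {τ π} → τ ⊆ π → τ ∈ subsequences π
⊆⇒∈-subsequences {π = []}    []        = here refl
⊆⇒∈-subsequences {π = x ∷ π} (.x ∷ʳ τ⊆π)  = ∈-++⁺ʳ (map (x ∷_) (subsequences π)) (⊆⇒∈-subsequences τ⊆π)
⊆⇒∈-subsequences {π = x ∷ π} (refl ∷ τ⊆π) = ∈-++⁺ˡ (∈-map⁺ (x ∷_) (⊆⇒∈-subsequences τ⊆π))

∈-subsequences⇒⊆ : ∀ {τ} π → τ ∈ subsequences π → τ ⊆ π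
∈-subsequences⇒⊆ []      (here refl) = []
∈-subsequences⇒⊆ (x ∷ π) τ∈ with ∈-++⁻ (map (x ∷_) (subsequences π)) τ∈
... | inj₂ τ∈′ = x ∷ʳ ∈-subsequences⇒⊆ π τ∈′
... | inj₁ τ∈′ with ∈-map⁻ (x ∷_) τ∈′
...   | τ′ , τ′∈ , refl = refl ∷ ∈-subsequences⇒⊆ π τ′∈

contains⁺ : ∀ {π τ σ} → τ ⊆ π → T (orderIsomorphic τ σ) → T (contains π σ)
contains⁺ τ⊆π iso = any⁺ _ (lose (⊆⇒∈-subsequences τ⊆π) iso)

contains⁻ : ∀ π σ → T (contains π σ) → ∃ λ τ → τ ⊆ π × T (orderIsomorphic τ σ)
contains⁻ π σ c with find (any⁻ _ (subsequences π) c)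
... | τ , τ∈ , iso = τ , ∈-subsequences⇒⊆ π τ∈ , iso

avoidsAll⁺ : ∀ π σs → All (λ σ → ¬ T (contains π σ)) σs → T (avoidsAll π σs)
avoidsAll⁺ π σs avoids = all⁻ _ (All.map ¬T⇒T-not avoids)

avoidsAll⁻ : ∀ π σs → Any (λ σ → T (contains π σ)) σs → ¬ T (avoidsAll π σs)
avoidsAll⁻ π σs contained avoids = All¬⇒¬Any (All.map T-not⇒¬T (all⁺ _ σs avoids)) contained

orderIsomorphic-length : ∀ τ σ → T (orderIsomorphic τ σ) → length τ ≡ length σ
orderIsomorphic-length []      []      _   = refl
orderIsomorphic-length (x ∷ τ) (y ∷ σ) iso =
  cong suc (orderIsomorphic-length τ σ (proj₂ (Equivalence.to T-∧ iso)))

record SameOrder (x y a b : ℕ) : Set where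
  constructor sameOrder
  field
    forward  : (x <ᵇ y) ≡ (a <ᵇ b)
    backward : (y <ᵇ x) ≡ (b <ᵇ a)

OrderIso₃ : List ℕ → List ℕ → Set
OrderIso₃ (x ∷ y ∷ z ∷ []) (a ∷ b ∷ c ∷ []) = SameOrder x y a b × SameOrder x z a c × SameOrder y z b c
OrderIso₃ _                _                = ⊥

orderIsomorphic-resp : ∀ τ ρ σ → OrderIso₃ τ ρ → length σ ≡ 3 → orderIsomorphic τ σ ≡ orderIsomorphic ρ σ
orderIsomorphic-resp (x ∷ y ∷ z ∷ []) (a ∷ b ∷ c ∷ []) (_ ∷ _ ∷ _ ∷ [])
                     (sameOrder xy yx , sameOrder xz zx , sameOrder yz zy) _
  rewrite xy | yx | xz | zx | yz | zy = refl

same-< : ∀ {x y a b} → x < y → T (a <ᵇ b) → SameOrder x y a b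
same-< {a = a} {b} x<y a<b = sameOrder
  (trans (<ᵇ-true x<y) (sym (<ᵇ-true (<ᵇ⇒< a b a<b))))
  (trans (<ᵇ-false (<⇒≤ x<y)) (sym (<ᵇ-false (<⇒≤ (<ᵇ⇒< a b a<b)))))

same-> : ∀ {x y a b} → y < x → T (b <ᵇ a) → SameOrder x y a b
same-> {x} {y} {a} {b} y<x b<a = let sameOrder p q = same-< {y} {x} {b} {a} y<x b<a in sameOrder q p

OrderIso₃⇒orderIsomorphic : ∀ {x y z} a b c → OrderIso₃ (x ∷ y ∷ z ∷ []) (a ∷ b ∷ c ∷ []) →
  T (orderIsomorphic (a ∷ b ∷ c ∷ []) (a ∷ b ∷ c ∷ [])) →
  T (orderIsomorphic (x ∷ y ∷ z ∷ []) (a ∷ b ∷ c ∷ []))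
OrderIso₃⇒orderIsomorphic {x} {y} {z} a b c iso refl-iso =
  subst T (sym (orderIsomorphic-resp (x ∷ y ∷ z ∷ []) (a ∷ b ∷ c ∷ []) (a ∷ b ∷ c ∷ []) iso refl)) refl-iso

avoidsAll-by-triples : ∀ π σs allowed →
  (∀ {x y z} → (x ∷ y ∷ z ∷ []) ⊆ π → Any (OrderIso₃ (x ∷ y ∷ z ∷ [])) allowed) →
  All (λ σ → length σ ≡ 3) σs →
  T (all (λ σ → not (any (λ ρ → orderIsomorphic ρ σ) allowed)) σs) →
  T (avoidsAll π σs)
avoidsAll-by-triples π σs allowed classify triples fresh =
  avoidsAll⁺ π σs (All.zipWith (λ (len , new) → not-contained len new) (triples , all⁺ _ σs fresh))
  where
  not-contained : ∀ {σ} → length σ ≡ 3 → T (not (any (λ ρ → orderIsomorphic ρ σ) allowed)) → ¬ T (contains π σ)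
  not-contained {σ} len new contained =
    let τ , τ⊆π , iso = contains⁻ π σ contained in
    forbidden τ τ⊆π iso (trans (orderIsomorphic-length τ σ iso) len)
    where
    forbidden : ∀ τ → τ ⊆ π → T (orderIsomorphic τ σ) → length τ ≡ 3 → ⊥
    forbidden (x ∷ y ∷ z ∷ []) τ⊆π iso _ =
      T-not⇒¬T new (any⁺ _ (Any.map (λ {ρ} τ≅ρ → subst T (orderIsomorphic-resp _ ρ σ τ≅ρ len) iso)
                                   (classify τ⊆π)))

⊆-++⁻ : ∀ {xs : List A} ys zs → xs ⊆ ys ++ zs →
  ∃₂ λ xs₁ xs₂ → xs ≡ xs₁ ++ xs₂ × xs₁ ⊆ ys × xs₂ ⊆ zs
⊆-++⁻ {xs = xs} []       zs xs⊆zs = [] , xs , refl , minimum [] , xs⊆zs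
⊆-++⁻           (y ∷ ys) zs (.y ∷ʳ xs⊆) with ⊆-++⁻ ys zs xs⊆
... | xs₁ , xs₂ , refl , xs₁⊆ys , xs₂⊆zs = xs₁ , xs₂ , refl , y ∷ʳ xs₁⊆ys , xs₂⊆zs
⊆-++⁻           (y ∷ ys) zs (refl ∷ xs⊆) with ⊆-++⁻ ys zs xs⊆
... | xs₁ , xs₂ , refl , xs₁⊆ys , xs₂⊆zs = y ∷ xs₁ , xs₂ , refl , refl ∷ xs₁⊆ys , xs₂⊆zs

AllPairs-resp-⊆ : ∀ {R : A → A → Set} {xs ys} → xs ⊆ ys → AllPairs R ys → AllPairs R xs
AllPairs-resp-⊆ []             []         = []
AllPairs-resp-⊆ (y ∷ʳ xs⊆ys)   (_ ∷ pys)  = AllPairs-resp-⊆ xs⊆ys pys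
AllPairs-resp-⊆ (refl ∷ xs⊆ys) (px ∷ pys) = All-resp-⊆ xs⊆ys px ∷ AllPairs-resp-⊆ xs⊆ys pys

triple-⊆-++ : ∀ {R S Q : A → A → Set} {ys zs x y z} →
  AllPairs R ys → AllPairs S zs → All (λ u → All (Q u) zs) ys → (x ∷ y ∷ z ∷ []) ⊆ ys ++ zs →
  (R x y × R x z × R y z) ⊎ (R x y × Q x z × Q y z) ⊎ (Q x y × Q x z × S y z) ⊎ (S x y × S x z × S y z)
triple-⊆-++ {ys = ys} {zs} R-ys S-zs Q-ys-zs xyz⊆ with ⊆-++⁻ ys zs xyz⊆
... | [] , _ , refl , _ , ⊆zs with AllPairs-resp-⊆ ⊆zs S-zs
...   | (Sxy ∷ Sxz ∷ []) ∷ (Syz ∷ []) ∷ [] ∷ [] = inj₂ (inj₂ (inj₂ (Sxy , Sxz , Syz)))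
triple-⊆-++ R-ys S-zs Q-ys-zs xyz⊆ | _ ∷ [] , _ , refl , ⊆ys , ⊆zs
  with All-resp-⊆ ⊆ys Q-ys-zs | AllPairs-resp-⊆ ⊆zs S-zs
...   | Qx ∷ [] | (Syz ∷ []) ∷ [] ∷ [] with All-resp-⊆ ⊆zs Qx
...     | Qxy ∷ Qxz ∷ [] = inj₂ (inj₂ (inj₁ (Qxy , Qxz , Syz)))
triple-⊆-++ R-ys S-zs Q-ys-zs xyz⊆ | _ ∷ _ ∷ [] , _ , refl , ⊆ys , ⊆zs
  with All-resp-⊆ ⊆ys Q-ys-zs | AllPairs-resp-⊆ ⊆ys R-ys
...   | Qx ∷ Qy ∷ [] | (Rxy ∷ []) ∷ [] ∷ [] with All-resp-⊆ ⊆zs Qx | All-resp-⊆ ⊆zs Qy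
...     | Qxz ∷ [] | Qyz ∷ [] = inj₂ (inj₁ (Rxy , Qxz , Qyz))
triple-⊆-++ R-ys S-zs Q-ys-zs xyz⊆ | _ ∷ _ ∷ _ ∷ [] , [] , refl , ⊆ys , _ with AllPairs-resp-⊆ ⊆ys R-ys
... | (Rxy ∷ Rxz ∷ []) ∷ (Ryz ∷ []) ∷ [] ∷ [] = inj₁ (Rxy , Rxz , Ryz)

-- Lots that force a pattern

data Extends (c : ℕ) : Maybe ℕ → Maybe ℕ → Set where
  stays   : Extends c nothing nothing
  arrives : ∀ {y} → c ≤ y → Extends c nothing (just y)
  remains : ∀ {x} → Extends c (just x) (just x)

extends-refl : ∀ {c a} → Extends c a a
extends-refl {a = nothing} = stays
extends-refl {a = just x}  = remains

extends-trans : ∀ {c c′ a b d} → c ≤ c′ → Extends c a b → Extends c′ b d → Extends c a d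
extends-trans c≤c′ stays          stays          = stays
extends-trans c≤c′ stays          (arrives c′≤y) = arrives (≤-trans c≤c′ c′≤y)
extends-trans c≤c′ (arrives c≤y)  remains        = arrives c≤y
extends-trans c≤c′ remains        remains        = remains

extends-parkAt : ∀ c p pos s → Pointwise (Extends c) s (parkAt c p pos s)
extends-parkAt c p pos []            = []
extends-parkAt c p pos (just x ∷ s)  = remains ∷ extends-parkAt c p (suc pos) s
extends-parkAt c p pos (nothing ∷ s) with p ≤ᵇ pos
... | true  = arrives ≤-refl ∷ Pointwise.refl extends-refl
... | false = stays ∷ extends-parkAt c p (suc pos) s

extends-runParking : ∀ c ps s → Pointwise (Extends c) s (runParking c ps s)
extends-runParking c []       s = Pointwise.refl extends-refl
extends-runParking c (p ∷ ps) s =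
  Pointwise.transitive (extends-trans (n≤1+n c)) (extends-parkAt c p 1 s) (extends-runParking (suc c) ps (parkAt c p 1 s))

⊆-Pointwise : ∀ {R : Maybe ℕ → Maybe ℕ → Set} {xs ys zs} → xs ⊆ ys → Pointwise R ys zs → Sublist R xs zs
⊆-Pointwise []           []       = []
⊆-Pointwise (y ∷ʳ xs⊆ys) (_ ∷ rs) = _ ∷ʳ ⊆-Pointwise xs⊆ys rs
⊆-Pointwise (refl ∷ xs⊆ys) (r ∷ rs) = r ∷ ⊆-Pointwise xs⊆ys rs

Sublist-parked⁻ : ∀ {R : Maybe ℕ → Maybe ℕ → Set} {xs} π → Sublist R xs (parked π) →
  ∃ λ ys → ys ⊆ π × Pointwise (λ a y → R a (just y)) xs ys
Sublist-parked⁻ []      []         = [] , [] , []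
Sublist-parked⁻ (y ∷ π) (_ ∷ʳ sub) with Sublist-parked⁻ π sub
... | ys , ys⊆π , pw = ys , y ∷ʳ ys⊆π , pw
Sublist-parked⁻ (y ∷ π) (r ∷ sub) with Sublist-parked⁻ π sub
... | ys , ys⊆π , pw = y ∷ ys , refl ∷ ys⊆π , r ∷ pw

spots-in-completion : ∀ {c s F α β γ} → (α ∷ β ∷ γ ∷ []) ⊆ s → Pointwise (Extends c) s F → T (isFull F) →
  ∃ λ x → ∃ λ y → ∃ λ z → (x ∷ y ∷ z ∷ []) ⊆ occupants F
                          × Extends c α (just x) × Extends c β (just y) × Extends c γ (just z)
spots-in-completion {c} {F = F} αβγ⊆s s≤F full
  with Sublist-parked⁻ (occupants F) (subst (Sublist (Extends c) _) (isFull⇒parked F full) (⊆-Pointwise αβγ⊆s s≤F))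
... | x ∷ y ∷ z ∷ [] , xyz⊆ , ex ∷ ey ∷ ez ∷ [] = x , y , z , xyz⊆ , ex , ey , ez

vanishes-by-pattern : ∀ σs c s {α β γ} → (α ∷ β ∷ γ ∷ []) ⊆ s →
  (∀ ps {x y z} → (x ∷ y ∷ z ∷ []) ⊆ occupants (runParking c ps s) →
     Extends c α (just x) → Extends c β (just y) → Extends c γ (just z) →
     Any (λ σ → T (orderIsomorphic (x ∷ y ∷ z ∷ []) σ)) σs) →
  ∀ m → ways σs c s m ≡ 0
vanishes-by-pattern σs c s αβγ⊆s forced m =
  countᵇ-none {p = completesAvoiding σs c s} {xs = functions (length s) m} (All.tabulate λ {ps} _ good →
    let F = runParking c ps s
        full , avoids = Equivalence.to T-∧ good
        x , y , z , xyz⊆ , ex , ey , ez = spots-in-completion αβγ⊆s (extends-runParking c ps s) full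
    in avoidsAll⁻ (occupants F) σs (Any.map (contains⁺ {occupants F} xyz⊆) (forced ps xyz⊆ ex ey ez)) avoids)

vanishes-132 : ∀ σs {c s a b} → (1 ∷ 3 ∷ 2 ∷ []) ∈ σs → (just a ∷ nothing ∷ just b ∷ []) ⊆ s →
  a < b → b < c → ∀ m → ways σs c s m ≡ 0
vanishes-132 σs 132∈ sub a<b b<c = vanishes-by-pattern _ _ _ sub λ where
  _ _ remains (arrives c≤y) remains → let b<y = <-≤-trans b<c c≤y in
    Any.map (λ { refl → OrderIso₃⇒orderIsomorphic 1 3 2 (same-< (<-trans a<b b<y) _ , same-< a<b _ , same-> b<y _) _ }) 132∈

vanishes-231 : ∀ σs {c s a b} → (2 ∷ 3 ∷ 1 ∷ []) ∈ σs → (just a ∷ nothing ∷ just b ∷ []) ⊆ s →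
  b < a → a < c → ∀ m → ways σs c s m ≡ 0
vanishes-231 σs 231∈ sub b<a a<c = vanishes-by-pattern _ _ _ sub λ where
  _ _ remains (arrives c≤y) remains → let a<y = <-≤-trans a<c c≤y in
    Any.map (λ { refl → OrderIso₃⇒orderIsomorphic 2 3 1 (same-< a<y _ , same-> b<a _ , same-> (<-trans b<a a<y) _) _ }) 231∈

vanishes-213 : ∀ σs {c s a b} → (2 ∷ 1 ∷ 3 ∷ []) ∈ σs → (just a ∷ just b ∷ nothing ∷ []) ⊆ s →
  b < a → a < c → ∀ m → ways σs c s m ≡ 0
vanishes-213 σs 213∈ sub b<a a<c = vanishes-by-pattern _ _ _ sub λ where
  _ _ remains remains (arrives c≤z) → let a<z = <-≤-trans a<c c≤z in
    Any.map (λ { refl → OrderIso₃⇒orderIsomorphic 2 1 3 (same-> b<a _ , same-< a<z _ , same-< (<-trans b<a a<z) _) _ }) 213∈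

DistinctCarsBelow : ℕ → Lot → Set
DistinctCarsBelow c s = AllPairs _≢_ (occupants s) × All (_< c) (occupants s)

All-parkAt : ∀ {P : ℕ → Set} c p pos s → All P (occupants s) → P c → All P (occupants (parkAt c p pos s))
All-parkAt c p pos []            ps      pc = ps
All-parkAt c p pos (just x ∷ s)  (px ∷ ps) pc = px ∷ All-parkAt c p (suc pos) s ps pc
All-parkAt c p pos (nothing ∷ s) ps      pc with p ≤ᵇ pos
... | true  = pc ∷ ps
... | false = All-parkAt c p (suc pos) s ps pc

distinctCarsBelow-parkAt : ∀ c p pos s → DistinctCarsBelow c s → DistinctCarsBelow (suc c) (parkAt c p pos s)
distinctCarsBelow-parkAt c p pos [] (distinct , below) = distinct , All.map m<n⇒m<1+n below
distinctCarsBelow-parkAt c p pos (just x ∷ s) (x∉ ∷ distinct , x<c ∷ below)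
  with distinctCarsBelow-parkAt c p (suc pos) s (distinct , below)
... | distinct′ , below′ = All-parkAt c p (suc pos) s x∉ (<⇒≢ x<c) ∷ distinct′ , m<n⇒m<1+n x<c ∷ below′
distinctCarsBelow-parkAt c p pos (nothing ∷ s) (distinct , below) with p ≤ᵇ pos
... | true  = All.map (λ x<c → ≢-sym (<⇒≢ x<c)) below ∷ distinct , n<1+n c ∷ All.map m<n⇒m<1+n below
... | false = distinctCarsBelow-parkAt c p (suc pos) s (distinct , below)

distinct-runParking : ∀ c ps s → DistinctCarsBelow c s → AllPairs _≢_ (occupants (runParking c ps s))
distinct-runParking c []       s inv = proj₁ inv
distinct-runParking c (p ∷ ps) s inv =
  distinct-runParking (suc c) ps (parkAt c p 1 s) (distinctCarsBelow-parkAt c p 1 s inv)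

vanishes-between : ∀ σs {c s b} → (2 ∷ 1 ∷ 3 ∷ []) ∈ σs → (3 ∷ 1 ∷ 2 ∷ []) ∈ σs → DistinctCarsBelow c s →
  (nothing ∷ just b ∷ nothing ∷ []) ⊆ s → b < c → ∀ m → ways σs c s m ≡ 0
vanishes-between σs {c} {s} {b} 213∈ 312∈ inv sub b<c = vanishes-by-pattern _ _ _ sub forced
  where
  between : ∀ {x z} → b < x → b < z → AllPairs _≢_ (x ∷ b ∷ z ∷ []) →
    Any (λ σ → T (orderIsomorphic (x ∷ b ∷ z ∷ []) σ)) σs
  between {x} {z} b<x b<z distinct with <-cmp x z | distinct
  ... | tri< x<z _ _ | _ =
    Any.map (λ { refl → OrderIso₃⇒orderIsomorphic 2 1 3 (same-> b<x _ , same-< x<z _ , same-< b<z _) _ }) 213∈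
  ... | tri≈ _ x≡z _ | (_ ∷ x≢z ∷ []) ∷ _ = ⊥-elim (x≢z x≡z)
  ... | tri> _ _ z<x | _ =
    Any.map (λ { refl → OrderIso₃⇒orderIsomorphic 3 1 2 (same-> b<x _ , same-> z<x _ , same-< b<z _) _ }) 312∈

  forced : ∀ ps {x y z} → (x ∷ y ∷ z ∷ []) ⊆ occupants (runParking c ps s) →
    Extends c nothing (just x) → Extends c (just b) (just y) → Extends c nothing (just z) →
    Any (λ σ → T (orderIsomorphic (x ∷ y ∷ z ∷ []) σ)) σs
  forced ps xyz⊆ (arrives c≤x) remains (arrives c≤z) =
    between (<-≤-trans b<c c≤x) (<-≤-trans b<c c≤z) (AllPairs-resp-⊆ xyz⊆ (distinct-runParking c ps s inv))

-- Car numbers below are written as k + a and k + b + 1, the next entries of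
-- ascending a k and descending b k, so that parking the next car extends these runs
-- definitionally.
ascending : ℕ → ℕ → List ℕ
ascending a k = applyUpTo (_+ a) k

descending : ℕ → ℕ → List ℕ
descending b k = applyDownFrom (λ i → i + b + 1) k

ascending-snoc : ∀ a k → ascending a k ++ [ k + a ] ≡ ascending a (suc k)
ascending-snoc a k = applyUpTo-∷ʳ (_+ a) k

parked-ascending-snoc : ∀ a k s → parked (ascending a k) ++ just (k + a) ∷ s ≡ parked (ascending a (suc k)) ++ s
parked-ascending-snoc a k s = begin
  parked (ascending a k) ++ parked [ k + a ] ++ s    ≡⟨ ++-assoc (parked (ascending a k)) _ s ⟨
  (parked (ascending a k) ++ parked [ k + a ]) ++ s  ≡⟨ cong (_++ s) (map-++ just (ascending a k) _) ⟨
  parked (ascending a k ++ [ k + a ]) ++ s           ≡⟨ cong (λ X → parked X ++ s) (ascending-snoc a k) ⟩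
  parked (ascending a (suc k)) ++ s                  ∎
  where open ≡-Reasoning

ascending-increasing : ∀ a k → AllPairs _<_ (ascending a k)
ascending-increasing a k = AllPairs.applyUpTo⁺₁ (_+ a) k (λ i<j _ → +-monoˡ-< a i<j)

ascending-≥ : ∀ a k → All (a ≤_) (ascending a k)
ascending-≥ a k = applyUpTo⁺₁ (_+ a) k (λ {i} _ → m≤n+m a i)

ascending-< : ∀ a k → All (_< k + a) (ascending a k)
ascending-< a k = applyUpTo⁺₁ (_+ a) k (+-monoˡ-< a)

descending-decreasing : ∀ b k → AllPairs _>_ (descending b k)
descending-decreasing b k = AllPairs.applyDownFrom⁺₁ (λ i → i + b + 1) k (λ j<i _ → +-monoˡ-< 1 (+-monoˡ-< b j<i))

descending-> : ∀ b k → All (b <_) (descending b k)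
descending-> b k = applyDownFrom⁺₁ (λ i → i + b + 1) k (λ {i} _ → ≤-<-trans (m≤n+m b i) (m<m+n (i + b) z<s))

descending-< : ∀ b k → All (_< k + b + 1) (descending b k)
descending-< b k = applyDownFrom⁺₁ (λ i → i + b + 1) k (λ i<k → +-monoˡ-< 1 (+-monoˡ-< b i<k))

distinctCarsBelow-ascending : ∀ s a k → occupants s ≡ ascending a k → DistinctCarsBelow (k + a) s
distinctCarsBelow-ascending s a k eq = subst (λ L → AllPairs _≢_ L × All (_< k + a) L) (sym eq)
  (AllPairs.map <⇒≢ (ascending-increasing a k) , ascending-< a k)

distinctCarsBelow-descending : ∀ s b k → occupants s ≡ descending b k → DistinctCarsBelow (k + b + 1) s
distinctCarsBelow-descending s b k eq = subst (λ L → AllPairs _≢_ L × All (_< k + b + 1) L) (sym eq)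
  (AllPairs.map (λ y<x → ≢-sym (<⇒≢ y<x)) (descending-decreasing b k) , descending-< b k)

-- Rising factorials

rise : ℕ → ℕ → ℕ
rise r zero    = 1
rise r (suc b) = suc r * rise (suc r) b

rise-! : ∀ r b → r ! * rise r b ≡ (b + r) !
rise-! r zero    = *-identityʳ (r !)
rise-! r (suc b) = begin
  r ! * (suc r * rise (suc r) b)  ≡⟨ sym (*-assoc (r !) (suc r) _) ⟩
  r ! * suc r * rise (suc r) b    ≡⟨ cong (_* rise (suc r) b) (*-comm (r !) (suc r)) ⟩
  suc r ! * rise (suc r) b        ≡⟨ rise-! (suc r) b ⟩
  (b + suc r) !                   ≡⟨ cong _! (+-suc b r) ⟩
  (suc b + r) !                   ∎
  where open ≡-Reasoning

rise-1 : ∀ j → rise 1 j ≡ suc j !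
rise-1 j = trans (sym (+-identityʳ (rise 1 j))) (trans (rise-! 1 j) (cong _! (+-comm j 1)))

rise-0 : ∀ b → rise 0 b ≡ b !
rise-0 b = trans (sym (+-identityʳ (rise 0 b))) (trans (rise-! 0 b) (cong _! (+-identityʳ b)))

rises : ℕ → ℕ → ℕ
rises g h = sum (applyDownFrom (λ j → rise g (suc j)) (suc h))

sum-applyDownFrom-cong : ∀ {f g : ℕ → ℕ} n → (∀ j → f j ≡ g j) → sum (applyDownFrom f n) ≡ sum (applyDownFrom g n)
sum-applyDownFrom-cong zero    f≗g = refl
sum-applyDownFrom-cong (suc n) f≗g = cong₂ _+_ (f≗g n) (sum-applyDownFrom-cong n f≗g)

sum-applyDownFrom-* : ∀ k (f : ℕ → ℕ) n → sum (applyDownFrom (λ j → k * f j) n) ≡ k * sum (applyDownFrom f n)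
sum-applyDownFrom-* k f zero    = sym (*-zeroʳ k)
sum-applyDownFrom-* k f (suc n) = trans (cong (k * f n +_) (sum-applyDownFrom-* k f n)) (sym (*-distribˡ-+ k (f n) _))

sum-applyDownFrom-suc : ∀ (f : ℕ → ℕ) n → sum (applyDownFrom f (suc n)) ≡ sum (applyDownFrom (f ∘ suc) n) + f 0
sum-applyDownFrom-suc f zero    = +-comm (f 0) 0
sum-applyDownFrom-suc f (suc n) =
  trans (cong (f (suc n) +_) (sum-applyDownFrom-suc f n)) (sym (+-assoc (f (suc n)) _ (f 0)))

rises-suc : ∀ g h → rises g (suc h) ≡ suc g * rises (suc g) h + suc g
rises-suc g h = begin
  sum (applyDownFrom (λ j → suc g * rise (suc g) j) (suc (suc h)))
    ≡⟨ sum-applyDownFrom-* (suc g) (rise (suc g)) (suc (suc h)) ⟩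
  suc g * sum (applyDownFrom (rise (suc g)) (suc (suc h)))
    ≡⟨ cong (suc g *_) (sum-applyDownFrom-suc (rise (suc g)) (suc h)) ⟩
  suc g * (rises (suc g) h + 1)
    ≡⟨ *-distribˡ-+ (suc g) _ 1 ⟩
  suc g * rises (suc g) h + suc g * 1
    ≡⟨ cong (suc g * rises (suc g) h +_) (*-identityʳ (suc g)) ⟩
  suc g * rises (suc g) h + suc g ∎
  where open ≡-Reasoning

sumFactorials-applyDownFrom : ∀ {f : ℕ → ℕ} n → (∀ j → f j ≡ suc j !) → sum (applyDownFrom f n) ≡ sumFactorials n
sumFactorials-applyDownFrom {f} n f≗ = begin
  sum (applyDownFrom f n)                         ≡⟨ sum-applyDownFrom-cong n f≗ ⟩
  sum (applyDownFrom (λ j → suc j !) n)           ≡⟨ sum-↭ (↭-reverse (applyDownFrom (λ j → suc j !) n)) ⟨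
  sum (reverse (applyDownFrom (λ j → suc j !) n)) ≡⟨ cong sum (reverse-applyDownFrom (λ j → suc j !) n) ⟩
  sum (applyUpTo (λ j → suc j !) n)               ≡⟨ cong sum (map-applyUpTo suc _! n) ⟨
  sumFactorials n                                 ∎
  where open ≡-Reasoning

σ₁ σ₂ σ₃ : List (List ℕ)
σ₁ = (1 ∷ 3 ∷ 2 ∷ []) ∷ (2 ∷ 1 ∷ 3 ∷ []) ∷ (2 ∷ 3 ∷ 1 ∷ []) ∷ []
σ₂ = (1 ∷ 3 ∷ 2 ∷ []) ∷ (2 ∷ 1 ∷ 3 ∷ []) ∷ (3 ∷ 1 ∷ 2 ∷ []) ∷ []
σ₃ = (2 ∷ 1 ∷ 3 ∷ []) ∷ (2 ∷ 3 ∷ 1 ∷ []) ∷ (3 ∷ 1 ∷ 2 ∷ []) ∷ []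

-- Avoiding 132, 213 and 231.  The avoiders are k + r ⋯ r + 1 1 ⋯ r: after car 1 the
-- cars 2 ⋯ r extend a block to the right, and from then on each car must take the
-- vacancy just left of the block.
avoids-σ₁ : ∀ r k → T (avoidsAll (descending r k ++ ascending 1 r) σ₁)
avoids-σ₁ r k = avoidsAll-by-triples _ σ₁ ((3 ∷ 2 ∷ 1 ∷ []) ∷ (3 ∷ 1 ∷ 2 ∷ []) ∷ (1 ∷ 2 ∷ 3 ∷ []) ∷ [])
  classify (refl ∷ refl ∷ refl ∷ []) _
  where
  above : All (λ d → All (d >_) (ascending 1 r)) (descending r k)
  above = All.map (λ r<d → All.map (λ u<r+1 → ≤-<-trans (<+1⇒≤ u<r+1) r<d) (ascending-< 1 r)) (descending-> r k)

  classify : ∀ {x y z} → (x ∷ y ∷ z ∷ []) ⊆ descending r k ++ ascending 1 r → Any (OrderIso₃ (x ∷ y ∷ z ∷ [])) _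
  classify xyz⊆ with triple-⊆-++ (descending-decreasing r k) (ascending-increasing 1 r) above xyz⊆
  ... | inj₁ (y<x , z<x , z<y)               = here (same-> y<x _ , same-> z<x _ , same-> z<y _)
  ... | inj₂ (inj₁ (y<x , z<x , z<y))        = here (same-> y<x _ , same-> z<x _ , same-> z<y _)
  ... | inj₂ (inj₂ (inj₁ (y<x , z<x , y<z))) = there (here (same-> y<x _ , same-> z<x _ , same-< y<z _))
  ... | inj₂ (inj₂ (inj₂ (x<y , x<z , y<z))) = there (there (here (same-< x<y _ , same-< x<z _ , same-< y<z _)))

ways₁-descending : ∀ a k r →
  ways σ₁ (k + suc r + 1) (vacant a ++ parked (descending (suc r) k ++ ascending 1 (suc r))) a ≡ 1
ways₁-descending zero    k r =
  ways-parked σ₁ _ (descending (suc r) k ++ ascending 1 (suc r)) (avoids-σ₁ (suc r) k)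
ways₁-descending (suc a) k r = begin
  ways σ₁ c (vacant (suc a) ++ parked L) (suc a)
    ≡⟨ ways-step σ₁ c (vacant (suc a) ++ parked L) a (vacancies-vacant-parked (suc a) L) ⟩
  landings g c 0 (vacant (suc a) ++ parked L)
    ≡⟨ cong (landings g c 0) (vacant-suc a (parked L)) ⟩
  landings g c 0 (vacant a ++ nothing ∷ parked L)
    ≡⟨ landings-vacant-++-vanishing g c a (nothing ∷ parked L) (λ i j _ →
         vanishes-231 σ₁ (there (there (here refl))) (++ˡ (vacant i) (refl ∷ ++ˡ (vacant j) (refl ∷ 1∈L))) 1<c (n<1+n c) a) ⟩
  1 * g (vacant a ++ just c ∷ parked L) + landings (g ∘ (vacant a ++_) ∘ (nothing ∷_)) c 0 (parked L)
    ≡⟨ cong₂ _+_ (trans (*-identityˡ _) (ways₁-descending a (suc k) r)) (landings-parked _ c 0 L) ⟩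
  1 ∎
  where
  open ≡-Reasoning
  c = k + suc r + 1
  L = descending (suc r) k ++ ascending 1 (suc r)
  g = λ t → ways σ₁ (suc c) t a
  1∈L : (just 1 ∷ []) ⊆ parked L
  1∈L = map⁺ just (++ˡ (descending (suc r) k) (refl ∷ minimum _))
  1<c : 1 < c
  1<c = subst (1 <_) (+-comm 1 (k + suc r)) (s≤s (≤-trans (s≤s z≤n) (m≤n+m (suc r) k)))

ways₁-ascending : ∀ a r b →
  ways σ₁ (suc r + 1) (vacant a ++ parked (ascending 1 (suc r)) ++ vacant b) (a + b) ≡ rise (suc r) b
ways₁-ascending a r zero =
  trans (cong₂ (ways σ₁ (suc r + 1)) (cong (vacant a ++_) (++-identityʳ _)) (+-identityʳ a)) (ways₁-descending a 0 r)
ways₁-ascending a r (suc b) = begin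
  ways σ₁ c (vacant a ++ parked U ++ nothing ∷ vacant b) (a + suc b)
    ≡⟨ cong (ways σ₁ c _) (+-suc a b) ⟩
  ways σ₁ c (vacant a ++ parked U ++ nothing ∷ vacant b) (suc (a + b))
    ≡⟨ ways-step σ₁ c (vacant a ++ parked U ++ nothing ∷ vacant b) (a + b) vacancies-lot ⟩
  landings g c 0 (vacant a ++ parked U ++ nothing ∷ vacant b)
    ≡⟨ landings-vacant-++-vanishing g c a (parked U ++ nothing ∷ vacant b) (λ i j _ →
         vanishes-213 σ₁ (there (here refl)) (++ˡ (vacant i) (refl ∷ ++ˡ (vacant j) (refl ∷ ++ˡ (parked (tail U)) (refl ∷ minimum _))))
                      1<c (n<1+n c) (a + b)) ⟩
  landings (g ∘ (vacant a ++_)) c 0 (parked U ++ nothing ∷ vacant b)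
    ≡⟨ landings-parked-++ (g ∘ (vacant a ++_)) c 0 U (nothing ∷ vacant b) ⟩
  suc (length U + 0) * g (vacant a ++ parked U ++ just c ∷ vacant b)
    + landings (g ∘ (vacant a ++_) ∘ (parked U ++_) ∘ (nothing ∷_)) c 0 (vacant b)
    ≡⟨ cong₂ _+_ (cong₂ _*_ (cong suc (trans (+-identityʳ _) (length-applyUpTo (_+ 1) (suc r)))) next) right-dead ⟩
  suc (suc r) * rise (suc (suc r)) b + 0
    ≡⟨ +-identityʳ _ ⟩
  rise (suc r) (suc b) ∎
  where
  open ≡-Reasoning
  c = suc r + 1
  U = ascending 1 (suc r)
  tail : List ℕ → List ℕ
  tail []      = []
  tail (_ ∷ X) = X
  g = λ t → ways σ₁ (suc c) t (a + b)
  1<c : 1 < c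
  1<c = s≤s (m≤n+m 1 r)
  vacancies-lot : vacancies (vacant a ++ parked U ++ nothing ∷ vacant b) ≡ suc (a + b)
  vacancies-lot = trans (vacancies-vacant-++ a _)
    (trans (cong (a +_) (trans (vacancies-parked-++ U _) (cong suc (vacancies-vacant b)))) (+-suc a b))
  next : g (vacant a ++ parked U ++ just c ∷ vacant b) ≡ rise (suc (suc r)) b
  next = trans (cong (λ t → ways σ₁ (suc c) (vacant a ++ t) (a + b)) (parked-ascending-snoc 1 (suc r) (vacant b)))
               (ways₁-ascending a (suc r) b)
  right-dead : landings (g ∘ (vacant a ++_) ∘ (parked U ++_) ∘ (nothing ∷_)) c 0 (vacant b) ≡ 0
  right-dead = trans (cong (landings _ c 0) (sym (++-identityʳ (vacant b))))
    (landings-vacant-++-vanishing _ c b [] (λ i j _ →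
      vanishes-132 σ₁ (here refl) (++ˡ (vacant a) (refl ∷ ++ˡ (parked (tail U)) (refl ∷ ++ˡ (vacant i) (refl ∷ minimum _))))
                   1<c (n<1+n c) (a + b)))

ways₁-empty : ∀ n → ways σ₁ 1 (vacant (suc n)) (suc n) ≡ sum (applyDownFrom (rise 1) (suc n))
ways₁-empty n = begin
  ways σ₁ 1 (vacant (suc n)) (suc n)
    ≡⟨ ways-step σ₁ 1 (vacant (suc n)) n (vacancies-vacant (suc n)) ⟩
  landings g 1 0 (vacant (suc n))
    ≡⟨ cong (landings g 1 0) (++-identityʳ (vacant (suc n))) ⟨
  landings g 1 0 (vacant (suc n) ++ [])
    ≡⟨ landings-vacant-++ g 1 (suc n) [] (rise 1) (λ i j eq →
         trans (cong₂ (λ t m → ways σ₁ 2 (vacant i ++ just 1 ∷ t) m) (++-identityʳ (vacant j)) (sym (suc-injective eq)))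
               (ways₁-ascending i 0 j)) ⟩
  sum (applyDownFrom (rise 1) (suc n)) + 0
    ≡⟨ +-identityʳ _ ⟩
  sum (applyDownFrom (rise 1) (suc n)) ∎
  where
  open ≡-Reasoning
  g = λ t → ways σ₁ 2 t n

-- Avoiding 132, 213 and 312.  The avoiders are d + 1 ⋯ d + g d ⋯ 1: cars 1 ⋯ d each
-- take the last vacancy, car d + 1 takes the first spot, and from then on each car
-- extends the block at the left end.
avoids-σ₂ : ∀ a g b d → d + b < a → T (avoidsAll (ascending a g ++ descending b d) σ₂)
avoids-σ₂ a g b d d+b<a = avoidsAll-by-triples _ σ₂ ((1 ∷ 2 ∷ 3 ∷ []) ∷ (2 ∷ 3 ∷ 1 ∷ []) ∷ (3 ∷ 2 ∷ 1 ∷ []) ∷ [])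
  classify (refl ∷ refl ∷ refl ∷ []) _
  where
  above : All (λ u → All (u >_) (descending b d)) (ascending a g)
  above = All.map (λ a≤u → All.map (λ e<d+b+1 → <-≤-trans (≤-<-trans (<+1⇒≤ e<d+b+1) d+b<a) a≤u) (descending-< b d))
                  (ascending-≥ a g)

  classify : ∀ {x y z} → (x ∷ y ∷ z ∷ []) ⊆ ascending a g ++ descending b d → Any (OrderIso₃ (x ∷ y ∷ z ∷ [])) _
  classify xyz⊆ with triple-⊆-++ (ascending-increasing a g) (descending-decreasing b d) above xyz⊆
  ... | inj₁ (x<y , x<z , y<z)               = here (same-< x<y _ , same-< x<z _ , same-< y<z _)
  ... | inj₂ (inj₁ (x<y , z<x , z<y))        = there (here (same-< x<y _ , same-> z<x _ , same-> z<y _))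
  ... | inj₂ (inj₂ (inj₁ (y<x , z<x , z<y))) = there (there (here (same-> y<x _ , same-> z<x _ , same-> z<y _)))
  ... | inj₂ (inj₂ (inj₂ (y<x , z<x , z<y))) = there (there (here (same-> y<x _ , same-> z<x _ , same-> z<y _)))

ways₂-ascending : ∀ a g e b d → d + b < a →
  ways σ₂ (suc g + a) (parked (ascending a (suc g)) ++ vacant e ++ parked (descending b d)) e ≡ rise (suc g) e
ways₂-ascending a g zero b d below =
  trans (cong (λ t → ways σ₂ (suc g + a) t 0) (sym (map-++ just (ascending a (suc g)) (descending b d))))
        (ways-parked σ₂ _ (ascending a (suc g) ++ descending b d) (avoids-σ₂ a (suc g) b d below))
ways₂-ascending a g (suc e) b d below = begin
  ways σ₂ c (parked G ++ nothing ∷ vacant e ++ parked D) (suc e)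
    ≡⟨ ways-step-parked σ₂ c G (vacant e ++ parked D) e (vacancies-vacant-parked e D) ⟩
  suc (length G) * ways σ₂ (suc c) (parked G ++ just c ∷ vacant e ++ parked D) e + landings h c 0 (vacant e ++ parked D)
    ≡⟨ cong₂ _+_ (cong₂ _*_ (cong suc (length-applyUpTo (_+ a) (suc g))) next) later-dead ⟩
  suc (suc g) * rise (suc (suc g)) e + 0
    ≡⟨ +-identityʳ _ ⟩
  rise (suc g) (suc e) ∎
  where
  open ≡-Reasoning
  c = suc g + a
  G = ascending a (suc g)
  D = descending b d
  h = λ u → ways σ₂ (suc c) (parked G ++ nothing ∷ u) e
  next : ways σ₂ (suc c) (parked G ++ just c ∷ vacant e ++ parked D) e ≡ rise (suc (suc g)) e
  next = trans (cong (λ t → ways σ₂ (suc c) t e) (parked-ascending-snoc a (suc g) (vacant e ++ parked D)))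
               (ways₂-ascending a (suc g) e b d below)
  later-dead : landings h c 0 (vacant e ++ parked D) ≡ 0
  later-dead = trans
    (landings-vacant-++-vanishing h c e (parked D) (λ i j _ →
      vanishes-132 σ₂ (here refl) (refl ∷ ++ˡ (parked (applyUpTo (λ i → suc i + a) g)) (refl ∷ ++ˡ (vacant i) (refl ∷ minimum _)))
                   (s≤s (m≤n+m a g)) (n<1+n c) e))
    (landings-parked _ c 0 D)

ways₂-descending : ∀ e b d →
  ways σ₂ (d + b + 1) (vacant (suc e) ++ parked (descending b d)) (suc e) ≡ sum (applyDownFrom (rise 1) (suc e))
ways₂-descending zero b d = begin
  ways σ₂ c (vacant 1 ++ parked D) 1
    ≡⟨ ways-step σ₂ c (vacant 1 ++ parked D) 0 (vacancies-vacant-parked 1 D) ⟩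
  1 * ways σ₂ (suc c) (just c ∷ parked D) 0 + landings _ c 0 (parked D)
    ≡⟨ cong₂ _+_ (trans (*-identityˡ _) (ways₂-ascending c 0 0 b d (m<m+n _ z<s))) (landings-parked _ c 0 D) ⟩
  rise 1 0 + 0 ∎
  where
  open ≡-Reasoning
  c = d + b + 1
  D = descending b d
ways₂-descending (suc e) b d = begin
  ways σ₂ c (vacant (suc (suc e)) ++ parked D) (suc (suc e))
    ≡⟨ ways-step σ₂ c (vacant (suc (suc e)) ++ parked D) (suc e) (vacancies-vacant-parked (suc (suc e)) D) ⟩
  1 * h (just c ∷ vacant (suc e) ++ parked D) + landings (h ∘ (nothing ∷_)) c 0 (vacant (suc e) ++ parked D)
    ≡⟨ cong₂ _+_ (trans (*-identityˡ _) (ways₂-ascending c 0 (suc e) b d (m<m+n _ z<s)))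
                 (cong (landings _ c 0) (vacant-suc e (parked D))) ⟩
  rise 1 (suc e) + landings (h ∘ (nothing ∷_)) c 0 (vacant e ++ nothing ∷ parked D)
    ≡⟨ cong (rise 1 (suc e) +_) (landings-vacant-++-vanishing _ c e (nothing ∷ parked D) (λ i j _ →
         vanishes-between σ₂ (there (here refl)) (there (there (here refl))) (distinct i j)
                          (refl ∷ ++ˡ (vacant i) (refl ∷ ++ˡ (vacant j) (refl ∷ minimum _))) (n<1+n c) (suc e))) ⟩
  rise 1 (suc e) + (1 * h (nothing ∷ vacant e ++ just c ∷ parked D) + landings _ c 0 (parked D))
    ≡⟨ cong (rise 1 (suc e) +_)
            (cong₂ _+_ (trans (*-identityˡ _) (ways₂-descending e b (suc d))) (landings-parked _ c 0 D)) ⟩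
  rise 1 (suc e) + (sum (applyDownFrom (rise 1) (suc e)) + 0)
    ≡⟨ cong (rise 1 (suc e) +_) (+-identityʳ _) ⟩
  sum (applyDownFrom (rise 1) (suc (suc e))) ∎
  where
  open ≡-Reasoning
  c = d + b + 1
  D = descending b d
  h = λ t → ways σ₂ (suc c) t (suc e)
  distinct : ∀ i j → DistinctCarsBelow (suc c) (nothing ∷ vacant i ++ just c ∷ vacant j ++ nothing ∷ parked D)
  distinct i j = distinctCarsBelow-descending (nothing ∷ vacant i ++ just c ∷ vacant j ++ nothing ∷ parked D) b (suc d)
    (trans (occupants-vacant-++ i (just c ∷ vacant j ++ nothing ∷ parked D))
           (cong (c ∷_) (trans (occupants-vacant-++ j (nothing ∷ parked D)) (occupants-parked D))))

ways₂-empty : ∀ n → ways σ₂ 1 (vacant (suc n)) (suc n) ≡ sum (applyDownFrom (rise 1) (suc n))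
ways₂-empty n = trans (cong (λ s → ways σ₂ 1 s (suc n)) (sym (++-identityʳ (vacant (suc n))))) (ways₂-descending n 0 0)

-- Avoiding 213, 231 and 312.  The avoiders are 1 ⋯ g g + k ⋯ g + 1: cars 1 ⋯ g
-- extend a block at the left end, car g + 1 takes the last spot, and from then on
-- each car takes the last vacancy.
avoids-σ₃ : ∀ g k → T (avoidsAll (ascending 1 g ++ descending g k) σ₃)
avoids-σ₃ g k = avoidsAll-by-triples _ σ₃ ((1 ∷ 2 ∷ 3 ∷ []) ∷ (1 ∷ 3 ∷ 2 ∷ []) ∷ (3 ∷ 2 ∷ 1 ∷ []) ∷ [])
  classify (refl ∷ refl ∷ refl ∷ []) _
  where
  below : All (λ u → All (u <_) (descending g k)) (ascending 1 g)
  below = All.map (λ u<g+1 → All.map (λ g<e → ≤-<-trans (<+1⇒≤ u<g+1) g<e) (descending-> g k)) (ascending-< 1 g)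

  classify : ∀ {x y z} → (x ∷ y ∷ z ∷ []) ⊆ ascending 1 g ++ descending g k → Any (OrderIso₃ (x ∷ y ∷ z ∷ [])) _
  classify xyz⊆ with triple-⊆-++ (ascending-increasing 1 g) (descending-decreasing g k) below xyz⊆
  ... | inj₁ (x<y , x<z , y<z)               = here (same-< x<y _ , same-< x<z _ , same-< y<z _)
  ... | inj₂ (inj₁ (x<y , x<z , y<z))        = here (same-< x<y _ , same-< x<z _ , same-< y<z _)
  ... | inj₂ (inj₂ (inj₁ (x<y , x<z , z<y))) = there (here (same-< x<y _ , same-< x<z _ , same-> z<y _))
  ... | inj₂ (inj₂ (inj₂ (y<x , z<x , z<y))) = there (there (here (same-> y<x _ , same-> z<x _ , same-> z<y _)))

ways₃-descending : ∀ g e k →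
  ways σ₃ (suc k + g + 1) (parked (ascending 1 g) ++ vacant (suc e) ++ parked (descending g (suc k))) (suc e) ≡ suc g
ways₃-descending g zero k = begin
  ways σ₃ c (parked U ++ nothing ∷ parked D) 1
    ≡⟨ ways-step-parked σ₃ c U (parked D) 0 (vacancies-parked D) ⟩
  suc (length U) * ways σ₃ (suc c) (parked U ++ just c ∷ parked D) 0
    + landings (λ u → ways σ₃ (suc c) (parked U ++ nothing ∷ u) 0) c 0 (parked D)
    ≡⟨ cong₂ _+_ (cong₂ _*_ (cong suc (length-applyUpTo (_+ 1) g)) full)
                 (landings-parked (λ u → ways σ₃ (suc c) (parked U ++ nothing ∷ u) 0) c 0 D) ⟩
  suc g * 1 + 0
    ≡⟨ trans (+-identityʳ _) (*-identityʳ _) ⟩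
  suc g ∎
  where
  open ≡-Reasoning
  c = suc k + g + 1
  U = ascending 1 g
  D = descending g (suc k)
  full : ways σ₃ (suc c) (parked U ++ just c ∷ parked D) 0 ≡ 1
  full = trans (cong (λ t → ways σ₃ (suc c) t 0) (sym (map-++ just U (c ∷ D))))
               (ways-parked σ₃ _ (U ++ c ∷ D) (avoids-σ₃ g (suc (suc k))))
ways₃-descending g (suc e) k = begin
  ways σ₃ c (parked U ++ nothing ∷ vacant (suc e) ++ parked D) (suc (suc e))
    ≡⟨ ways-step-parked σ₃ c U (vacant (suc e) ++ parked D) (suc e) (vacancies-vacant-parked (suc e) D) ⟩
  suc (length U) * ways σ₃ (suc c) (parked U ++ just c ∷ vacant (suc e) ++ parked D) (suc e)
    + landings h c 0 (vacant (suc e) ++ parked D)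
    ≡⟨ cong₂ _+_ (cong (suc (length U) *_) first-dead) (cong (landings h c 0) (vacant-suc e (parked D))) ⟩
  suc (length U) * 0 + landings h c 0 (vacant e ++ nothing ∷ parked D)
    ≡⟨ cong₂ _+_ (*-zeroʳ (suc (length U))) (landings-vacant-++-vanishing h c e (nothing ∷ parked D) (λ i j _ →
         vanishes-231 σ₃ (there (here refl))
           (++ˡ (parked U) (nothing ∷ʳ ++ˡ (vacant i) (refl ∷ ++ˡ (vacant j) (refl ∷ refl ∷ minimum _))))
           (n<1+n (k + g + 1)) (n<1+n c) (suc e))) ⟩
  1 * ways σ₃ (suc c) (parked U ++ nothing ∷ vacant e ++ just c ∷ parked D) (suc e)
    + landings (λ u → h (vacant e ++ nothing ∷ u)) c 0 (parked D)
    ≡⟨ cong₂ _+_ (trans (*-identityˡ _) (ways₃-descending g e (suc k)))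
                 (landings-parked (λ u → h (vacant e ++ nothing ∷ u)) c 0 D) ⟩
  suc g + 0
    ≡⟨ +-identityʳ _ ⟩
  suc g ∎
  where
  open ≡-Reasoning
  c = suc k + g + 1
  U = ascending 1 g
  D = descending g (suc k)
  h = λ u → ways σ₃ (suc c) (parked U ++ nothing ∷ u) (suc e)
  first-dead : ways σ₃ (suc c) (parked U ++ just c ∷ vacant (suc e) ++ parked D) (suc e) ≡ 0
  first-dead = vanishes-231 σ₃ (there (here refl)) (++ˡ (parked U) (refl ∷ refl ∷ ++ˡ (vacant e) (refl ∷ minimum _)))
                            (n<1+n (k + g + 1)) (n<1+n c) (suc e)

ways₃-ascending : ∀ g h → ways σ₃ (g + 1) (parked (ascending 1 g) ++ vacant (suc h)) (suc h) ≡ rises g h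
ways₃-ascending g zero = begin
  ways σ₃ c (parked U ++ nothing ∷ []) 1
    ≡⟨ ways-step-parked σ₃ c U [] 0 refl ⟩
  suc (length U) * ways σ₃ (suc c) (parked U ++ just c ∷ []) 0 + 0
    ≡⟨ cong (_+ 0) (cong₂ _*_ (cong suc (length-applyUpTo (_+ 1) g)) full) ⟩
  suc g * 1 + 0 ∎
  where
  open ≡-Reasoning
  c = g + 1
  U = ascending 1 g
  full : ways σ₃ (suc c) (parked U ++ just c ∷ []) 0 ≡ 1
  full = trans (cong (λ t → ways σ₃ (suc c) t 0) (sym (map-++ just U [ c ])))
               (ways-parked σ₃ _ (U ++ [ c ]) (avoids-σ₃ g 1))
ways₃-ascending g (suc h) = begin
  ways σ₃ c (parked U ++ nothing ∷ vacant (suc h)) (suc (suc h))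
    ≡⟨ ways-step-parked σ₃ c U (vacant (suc h)) (suc h) (vacancies-vacant (suc h)) ⟩
  suc (length U) * ways σ₃ (suc c) (parked U ++ just c ∷ vacant (suc h)) (suc h) + landings hh c 0 (vacant (suc h))
    ≡⟨ cong₂ _+_ (cong₂ _*_ (cong suc (length-applyUpTo (_+ 1) g)) next)
                 (cong (landings hh c 0) (trans (sym (++-identityʳ (vacant (suc h)))) (vacant-suc h []))) ⟩
  suc g * rises (suc g) h + landings hh c 0 (vacant h ++ nothing ∷ [])
    ≡⟨ cong (suc g * rises (suc g) h +_) (landings-vacant-++-vanishing hh c h (nothing ∷ []) (λ i j _ →
         vanishes-between σ₃ (here refl) (there (there (here refl))) (distinct i j)
           (++ˡ (parked U) (refl ∷ ++ˡ (vacant i) (refl ∷ ++ˡ (vacant j) (refl ∷ minimum _)))) (n<1+n c) (suc h))) ⟩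
  suc g * rises (suc g) h + (1 * ways σ₃ (suc c) (parked U ++ nothing ∷ vacant h ++ just c ∷ []) (suc h) + 0)
    ≡⟨ cong (λ x → suc g * rises (suc g) h + (x + 0)) (trans (*-identityˡ _) (ways₃-descending g h 0)) ⟩
  suc g * rises (suc g) h + (suc g + 0)
    ≡⟨ cong (suc g * rises (suc g) h +_) (+-identityʳ (suc g)) ⟩
  suc g * rises (suc g) h + suc g
    ≡⟨ rises-suc g h ⟨
  rises g (suc h) ∎
  where
  open ≡-Reasoning
  c = g + 1
  U = ascending 1 g
  hh = λ u → ways σ₃ (suc c) (parked U ++ nothing ∷ u) (suc h)
  next : ways σ₃ (suc c) (parked U ++ just c ∷ vacant (suc h)) (suc h) ≡ rises (suc g) h
  next = trans (cong (λ t → ways σ₃ (suc c) t (suc h)) (parked-ascending-snoc 1 g (vacant (suc h))))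
               (ways₃-ascending (suc g) h)
  distinct : ∀ i j → DistinctCarsBelow (suc c) (parked U ++ nothing ∷ vacant i ++ just c ∷ vacant j ++ nothing ∷ [])
  distinct i j = distinctCarsBelow-ascending (parked U ++ nothing ∷ vacant i ++ just c ∷ vacant j ++ nothing ∷ [])
                                             1 (suc g)
    (trans (occupants-parked-++ U _)
           (trans (cong (U ++_) (trans (occupants-vacant-++ i _) (cong (c ∷_) (occupants-vacant-++ j (nothing ∷ [])))))
                  (ascending-snoc 1 g)))

ways₃-empty : ∀ n → ways σ₃ 1 (vacant (suc n)) (suc n) ≡ rises 0 n
ways₃-empty = ways₃-ascending 0

mainTheorem19 : (n : ℕ) → n ≥ 1 →
    (pk n ((1 ∷ 3 ∷ 2 ∷ []) ∷ (2 ∷ 1 ∷ 3 ∷ []) ∷ (2 ∷ 3 ∷ 1 ∷ []) ∷ []) ≡ sumFactorials n)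
    × (pk n ((1 ∷ 3 ∷ 2 ∷ []) ∷ (2 ∷ 1 ∷ 3 ∷ []) ∷ (3 ∷ 1 ∷ 2 ∷ []) ∷ []) ≡ sumFactorials n)
    × (pk n ((2 ∷ 1 ∷ 3 ∷ []) ∷ (2 ∷ 3 ∷ 1 ∷ []) ∷ (3 ∷ 1 ∷ 2 ∷ []) ∷ []) ≡ sumFactorials n)
mainTheorem19 (suc n) _ =
  trans (pk≡ways (suc n) σ₁) (trans (ways₁-empty n) (sumFactorials-applyDownFrom (suc n) rise-1)) ,
  trans (pk≡ways (suc n) σ₂) (trans (ways₂-empty n) (sumFactorials-applyDownFrom (suc n) rise-1)) ,
  trans (pk≡ways (suc n) σ₃) (trans (ways₃-empty n) (sumFactorials-applyDownFrom (suc n) (rise-0 ∘ suc)))
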